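{- Let $b\ge1$ and let $A\subseteq\mathbb{N}$ be a nonempty finite set. Let $f\in\mathcal{M}^b$ be the element with set-array representation $(A,\emptyset,\ldots,\emptyset)$ (i.e. the indicator function of $A$). Then \[d(f)=\sum_{B}b^{|B|},\] where the sum runs over all additive divisors $B$ of $A$.
   Context: $\mathbb{N}=\{0,1,2,\ldots\}$, $X+Y=\{x+y:x\in X,y\in Y\}$, $X+\emptyset=\emptyset$. A set $B\subseteq\mathbb{N}$ is an additive divisor of $A$ if $B+C=A$ for some $C\subseteq\mathbb{N}$. $\mathcal{M}^b$ is the set of functions $f:\mathbb{N}\to\{0,\ldots,b\}$ with finite support; the set-array representation of $f$ is $(A_1,\ldots,A_b)$ with $A_i=\{a:f(a)\ge i\}$. The sum of $f,g\in\mathcal{M}^b$ with set arrays $(A_i),(B_i)$ is the element with set array $(A_1+B_1,\ldots,A_b+B_b)$. $g\in\mathcal{M}^b$ is a divisor of $f$ if $f=g+h$ for some $h\in\mathcal{M}^b$; $d(f)$ (for $f$ not identically $0$) is the number of divisors of $f$ in $\mathcal{M}^b$. -}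

module Defs where

open import Data.Nat using (ℕ; zero; suc; _+_; _^_; _≤_)
open import Data.Bool using (Bool; true; false; if_then_else_)
open import Data.List using (List; []; _∷_; length; map)
open import Data.Nat.ListAction using (sum)
open import Data.List.Relation.Unary.All using (All)
open import Data.List.Relation.Unary.Any using (Any)
open import Data.List.Relation.Unary.AllPairs using (AllPairs)
open import Data.Product using (Σ; ∃; ∃-syntax; _×_; _,_; proj₁; proj₂)
open import Relation.Binary.PropositionalEquality using (_≡_)
open import Relation.Nullary using (¬_)

Subset : Set
Subset = ℕ → Bool

_∈ˢ_ : ℕ → Subset → Set
x ∈ˢ A = A x ≡ true

FiniteSet : Subset → Set
FiniteSet A = ∃[ N ] (∀ x → N ≤ x → A x ≡ false)

NonemptySet : Subset → Set
NonemptySet A = ∃[ x ] (x ∈ˢ A)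

InSumset : Subset → Subset → ℕ → Set
InSumset X Y x = ∃[ y ] ∃[ z ] (y + z ≡ x × y ∈ˢ X × z ∈ˢ Y)

AdditiveDivisor : Subset → Subset → Set
AdditiveDivisor A B =
  ∃[ C ] (∀ x → (x ∈ˢ A → InSumset B C x) × (InSumset B C x → x ∈ˢ A))

countBelow : Subset → ℕ → ℕ
countBelow A zero = zero
countBelow A (suc n) = (if A n then 1 else 0) + countBelow A n

IsCard : Subset → ℕ → Set
IsCard B k = ∃[ N ] ((∀ x → N ≤ x → B x ≡ false) × countBelow B N ≡ k)

SetEq : Subset → Subset → Set
SetEq B B' = ∀ x → B x ≡ B' x

-- Σ_{B additive divisor of A} b^|B| = n :
-- a duplicate-free list enumerating all additive divisors (up to set equality),
-- each paired with its cardinality, whose weights sum to n.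
SumOverAdditiveDivisors : ℕ → Subset → ℕ → Set
SumOverAdditiveDivisors b A n =
  Σ (List (Subset × ℕ)) λ Bs →
    All (λ p → AdditiveDivisor A (proj₁ p) × IsCard (proj₁ p) (proj₂ p)) Bs
    × AllPairs (λ p q → ¬ SetEq (proj₁ p) (proj₁ q)) Bs
    × (∀ B → AdditiveDivisor A B → Any (λ p → SetEq B (proj₁ p)) Bs)
    × sum (map (λ p → b ^ proj₂ p) Bs) ≡ n

InM : ℕ → (ℕ → ℕ) → Set
InM b f = (∀ x → f x ≤ b) × ∃[ N ] (∀ x → N ≤ x → f x ≡ 0)

-- i-th set of the set-array representation: A_i = {a : f a ≥ i}
-- f = g + h in 𝓜^b : for each 1 ≤ i ≤ b, A_i(f) = A_i(g) + A_i(h)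
IsSumM : ℕ → (ℕ → ℕ) → (ℕ → ℕ) → (ℕ → ℕ) → Set
IsSumM b g h f =
  ∀ i → 1 ≤ i → i ≤ b → ∀ x →
    (i ≤ f x → ∃[ y ] ∃[ z ] (y + z ≡ x × i ≤ g y × i ≤ h z))
    × (∃[ y ] ∃[ z ] (y + z ≡ x × i ≤ g y × i ≤ h z) → i ≤ f x)

DivisorM : ℕ → (ℕ → ℕ) → (ℕ → ℕ) → Set
DivisorM b f g = InM b g × ∃[ h ] (InM b h × IsSumM b g h f)

FunEq : (ℕ → ℕ) → (ℕ → ℕ) → Set
FunEq g g' = ∀ x → g x ≡ g' x

NumDivisors : ℕ → (ℕ → ℕ) → ℕ → Set
NumDivisors b f n =
  Σ (List (ℕ → ℕ)) λ gs →
    All (DivisorM b f) gs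
    × AllPairs (λ g g' → ¬ FunEq g g') gs
    × (∀ g → DivisorM b f g → Any (FunEq g) gs)
    × length gs ≡ n

indicator : Subset → ℕ → ℕ
indicator A x = if A x then 1 else 0

-- A divisor g of the indicator of A is determined by its support B together with arbitrary values
-- in {1,…,b} on B. At level 1 the set-array condition reads supp g + supp h = A, so B is an additive
-- divisor of A; conversely, for any complement C of B the partner h = indicator C works, all levels
-- above 1 being empty on both sides. Both sides are computed by enumerating
-- the finitely many candidates: if A ⊆ [0,N) then so is every additive divisor B, and B divides A
-- iff B + C_B = A for the maximal complement C_B = {c : B + c ⊆ A}, which is decidable.
module Submission where

open import Defs
open import Data.Nat using (ℕ; zero; suc; _+_; _*_; _^_; _∸_; _<_; _≤_; z≤n; s≤s; s<s; z<s)
open import Data.Nat.Properties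
  using ( *-identityʳ; *-comm; ^-distribˡ-+-*; ≤-refl; ≤-trans; ≰⇒>; <⇒≱; <⇒≢; ≤-<-connex
        ; m≤m+n; m≤n+m; m+[n∸m]≡n; m+n∸m≡n; suc-injective; allUpTo?; anyUpTo?)
open import Data.Nat.ListAction using (sum; product)
open import Data.Nat.ListAction.Properties using (product-++)
open import Data.Bool using (Bool; true; false; if_then_else_) renaming (_≟_ to _≟ᵇ_)
open import Data.Bool.Properties using (¬-not)
open import Data.List using (List; []; _∷_; [_]; _++_; length; map; concatMap; filter; applyUpTo)
open import Data.List.Properties using (length-map; length-++; length-applyUpTo; applyUpTo-∷ʳ; map-cong; map-∘)
open import Data.List.Membership.Propositional using (_∈_; lose; find)
open import Data.List.Membership.Propositional.Properties using (∈-map⁻; ∈-filter⁻; ∈-filter⁺)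
open import Data.List.Relation.Unary.Any as Any using (Any; here; there)
import Data.List.Relation.Unary.Any.Properties as Anyₚ
open import Data.List.Relation.Unary.All as All using (All)
import Data.List.Relation.Unary.All.Properties as Allₚ
open import Data.List.Relation.Unary.AllPairs as AllPairs using (AllPairs; []; _∷_)
import Data.List.Relation.Unary.AllPairs.Properties as AllPairsₚ
open import Data.Product using (∃; ∃-syntax; _×_; _,_; proj₁; proj₂)
open import Data.Sum using (inj₁; inj₂)
open import Data.Empty using (⊥-elim)
open import Function using (_∘_; const)
open import Relation.Binary.PropositionalEquality
  using (_≡_; _≢_; refl; _≗_; sym; trans; subst; cong; cong₂; module ≡-Reasoning)
open import Relation.Nullary using (¬_; Dec; yes; no; does)
open import Relation.Nullary.Decidable using (_×-dec_; _→-dec_)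

length-concatMap : {X Y : Set} (f : X → List Y) (xs : List X) →
                   length (concatMap f xs) ≡ sum (map (length ∘ f) xs)
length-concatMap f [] = refl
length-concatMap f (x ∷ xs) = trans (length-++ (f x)) (cong (length (f x) +_) (length-concatMap f xs))

sum-map-const : {X : Set} (k : ℕ) (xs : List X) → sum (map (const k) xs) ≡ length xs * k
sum-map-const k [] = refl
sum-map-const k (x ∷ xs) = cong (k +_) (sum-map-const k xs)

AgreeBelow : {V : Set} → ℕ → (ℕ → V) → (ℕ → V) → Set
AgreeBelow n f g = ∀ {x} → x < n → f x ≡ g x

_◃_ : {V : Set} → V → (ℕ → V) → ℕ → V
(v ◃ f) zero = v
(v ◃ f) (suc x) = f x

module _ {V : Set} where

  functionsBelow : (ℕ → List V) → V → ℕ → List (ℕ → V)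
  extensions : (ℕ → List V) → V → ℕ → V → List (ℕ → V)

  functionsBelow choices d zero = [ const d ]
  functionsBelow choices d (suc n) = concatMap (extensions choices d n) (choices 0)

  extensions choices d n v = map (v ◃_) (functionsBelow (choices ∘ suc) d n)

  ChosenBelow : (ℕ → List V) → V → ℕ → (ℕ → V) → Set
  ChosenBelow choices d n f = (∀ {x} → x < n → f x ∈ choices x) × (∀ {x} → n ≤ x → f x ≡ d)

  ∈-functionsBelow⁻ : ∀ choices d n {f} → f ∈ functionsBelow choices d n → ChosenBelow choices d n f
  ∈-functionsBelow⁻ choices d zero (here refl) = (λ ()) , λ _ → refl
  ∈-functionsBelow⁻ choices d (suc n) f∈
    with find (Anyₚ.concatMap⁻ (extensions choices d n) {xs = choices 0} f∈)
  ... | v , v∈ , f∈map with ∈-map⁻ (v ◃_) f∈map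
  ... | g , g∈ , refl = chosen , default
    where
    g-chosen = ∈-functionsBelow⁻ (choices ∘ suc) d n g∈
    chosen : ∀ {x} → x < suc n → (v ◃ g) x ∈ choices x
    chosen {zero} _ = v∈
    chosen {suc x} (s<s x<n) = proj₁ g-chosen x<n
    default : ∀ {x} → suc n ≤ x → (v ◃ g) x ≡ d
    default {suc x} (s≤s n≤x) = proj₂ g-chosen n≤x

  functionsBelow-complete : ∀ choices d n {f} → ChosenBelow choices d n f →
                            Any (f ≗_) (functionsBelow choices d n)
  functionsBelow-complete choices d zero (_ , default) = here (λ _ → default z≤n)
  functionsBelow-complete choices d (suc n) {f} (chosen , default) =
    Anyₚ.concatMap⁺ (extensions choices d n)
      (Any.map (λ { refl → Anyₚ.map⁺ (Any.map ◃-cong tail-found) }) (chosen (s≤s z≤n)))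
    where
    tail-found : Any ((f ∘ suc) ≗_) (functionsBelow (choices ∘ suc) d n)
    tail-found = functionsBelow-complete (choices ∘ suc) d n (chosen ∘ s<s , default ∘ s≤s)
    ◃-cong : ∀ {g} → f ∘ suc ≗ g → f ≗ (f 0 ◃ g)
    ◃-cong eq zero = refl
    ◃-cong eq (suc x) = eq x

  functionsBelow-distinct : ∀ {choices} d n → (∀ x → AllPairs _≢_ (choices x)) →
                            AllPairs (λ f g → ¬ AgreeBelow n f g) (functionsBelow choices d n)
  functionsBelow-distinct d zero _ = All.[] ∷ []
  functionsBelow-distinct {choices} d (suc n) distinct =
    AllPairsₚ.concat⁺ (Allₚ.map⁺ (All.universal (λ v → AllPairsₚ.map⁺ (AllPairs.map tail-distinct rest)) _))
                     (AllPairsₚ.map⁺ (AllPairs.map head-distinct (distinct 0)))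
    where
    rest = functionsBelow-distinct d n (distinct ∘ suc)
    tail-distinct : ∀ {v g g'} → ¬ AgreeBelow n g g' → ¬ AgreeBelow (suc n) (v ◃ g) (v ◃ g')
    tail-distinct g≉g' agree = g≉g' (agree ∘ s<s)
    head-distinct : ∀ {v v'} → v ≢ v' →
                    All (λ f → All (λ f' → ¬ AgreeBelow (suc n) f f') (extensions choices d n v'))
                        (extensions choices d n v)
    head-distinct v≢v' =
      Allₚ.map⁺ (All.universal (λ _ → Allₚ.map⁺ (All.universal (λ _ agree → v≢v' (agree z<s)) _)) _)

  length-functionsBelow : ∀ choices d n →
                          length (functionsBelow choices d n) ≡ product (applyUpTo (length ∘ choices) n)
  length-functionsBelow choices d zero = refl
  length-functionsBelow choices d (suc n) = begin
    length (concatMap (extensions choices d n) (choices 0))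
      ≡⟨ length-concatMap (extensions choices d n) (choices 0) ⟩
    sum (map (length ∘ extensions choices d n) (choices 0))
      ≡⟨ cong sum (map-cong (λ v → length-map (v ◃_) rest) (choices 0)) ⟩
    sum (map (const (length rest)) (choices 0))
      ≡⟨ sum-map-const (length rest) (choices 0) ⟩
    length (choices 0) * length rest
      ≡⟨ cong (length (choices 0) *_) (length-functionsBelow (choices ∘ suc) d n) ⟩
    product (applyUpTo (length ∘ choices) (suc n)) ∎
    where
    open ≡-Reasoning
    rest = functionsBelow (choices ∘ suc) d n

BoundedBy : ℕ → Subset → Set
BoundedBy N A = ∀ x → N ≤ x → A x ≡ false

agreeBelow⇒≗ : ∀ {N B B'} → BoundedBy N B → BoundedBy N B' → AgreeBelow N B B' → B ≗ B'
agreeBelow⇒≗ {N} B-bounded B'-bounded agree x with ≤-<-connex N x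
... | inj₁ N≤x = trans (B-bounded x N≤x) (sym (B'-bounded x N≤x))
... | inj₂ x<N = agree x<N

IsSumset : Subset → Subset → Subset → Set
IsSumset B C A = ∀ x → (x ∈ˢ A → InSumset B C x) × (InSumset B C x → x ∈ˢ A)

boundedBy⇒< : ∀ {N A x} → BoundedBy N A → x ∈ˢ A → x < N
boundedBy⇒< {N} {A} {x} bounded x∈A = ≰⇒> λ N≤x → excluded (trans (sym x∈A) (bounded x N≤x))
  where
  excluded : true ≢ false
  excluded ()

additiveDivisor-resp : ∀ {A B B'} → B ≗ B' → AdditiveDivisor A B → AdditiveDivisor A B'
additiveDivisor-resp B≗B' (C , A≐B+C) = C , λ x →
    (λ x∈A → let y , z , y+z≡x , y∈B , z∈C = proj₁ (A≐B+C x) x∈A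
             in y , z , y+z≡x , trans (sym (B≗B' y)) y∈B , z∈C)
  , (λ (y , z , y+z≡x , y∈B' , z∈C) → proj₂ (A≐B+C x) (y , z , y+z≡x , trans (B≗B' y) y∈B' , z∈C))

summands-nonempty : ∀ {A B C} → NonemptySet A → IsSumset B C A → NonemptySet B × NonemptySet C
summands-nonempty (a , a∈A) A≐B+C =
  let y , z , _ , y∈B , z∈C = proj₁ (A≐B+C a) a∈A in (y , y∈B) , (z , z∈C)

module _ {N : ℕ} {A B C : Subset} (A-bounded : BoundedBy N A) (A≐B+C : IsSumset B C A) where

  isSumset-boundedˡ : ∀ {z} → z ∈ˢ C → BoundedBy N B
  isSumset-boundedˡ {z} z∈C y N≤y = ¬-not λ y∈B →
    <⇒≱ (boundedBy⇒< A-bounded (proj₂ (A≐B+C (y + z)) (y , z , refl , y∈B , z∈C)))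
        (≤-trans N≤y (m≤m+n y z))

  isSumset-boundedʳ : ∀ {y} → y ∈ˢ B → BoundedBy N C
  isSumset-boundedʳ {y} y∈B z N≤z = ¬-not λ z∈C →
    <⇒≱ (boundedBy⇒< A-bounded (proj₂ (A≐B+C (y + z)) (y , z , refl , y∈B , z∈C)))
        (≤-trans N≤z (m≤n+m z y))

module MaximalComplement {N : ℕ} {A : Subset} (A-bounded : BoundedBy N A) where

  shiftsInto? : (B : Subset) (c : ℕ) → Dec (∀ {y} → y < N → y ∈ˢ B → (y + c) ∈ˢ A)
  shiftsInto? B c = allUpTo? (λ y → (B y ≟ᵇ true) →-dec (A (y + c) ≟ᵇ true)) N

  -- C_B = {c : B + c ⊆ A}, tested on y < N only, which is faithful for B ⊆ [0,N).
  maximalComplement : Subset → Subset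
  maximalComplement B c = does (shiftsInto? B c)

  maximalComplement-sound : ∀ {B c y} → BoundedBy N B → c ∈ˢ maximalComplement B → y ∈ˢ B → (y + c) ∈ˢ A
  maximalComplement-sound {B} {c} B-bounded c∈ y∈B with shiftsInto? B c
  ... | yes shifts = shifts (boundedBy⇒< B-bounded y∈B) y∈B

  maximalComplement-maximal : ∀ {B C} → IsSumset B C A → ∀ {z} → z ∈ˢ C → z ∈ˢ maximalComplement B
  maximalComplement-maximal {B} A≐B+C {z} z∈C with shiftsInto? B z
  ... | yes _ = refl
  ... | no ¬shifts = ⊥-elim (¬shifts λ {y} _ y∈B → proj₂ (A≐B+C (y + z)) (y , z , refl , y∈B , z∈C))

  -- A finitely checkable form of A ⊆ B + C_B: the summand y of x ranges over y ≤ x.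
  Covers : Subset → Set
  Covers B = ∀ {x} → x < N → x ∈ˢ A → ∃ λ y → y < suc x × y ∈ˢ B × (x ∸ y) ∈ˢ maximalComplement B

  covers? : (B : Subset) → Dec (Covers B)
  covers? B = allUpTo? (λ x → (A x ≟ᵇ true) →-dec
                anyUpTo? (λ y → (B y ≟ᵇ true) ×-dec (maximalComplement B (x ∸ y) ≟ᵇ true)) (suc x)) N

  covers⇒isSumset : ∀ {B} → BoundedBy N B → Covers B → IsSumset B (maximalComplement B) A
  covers⇒isSumset B-bounded covers x = decompose , compose
    where
    decompose : x ∈ˢ A → InSumset _ _ x
    decompose x∈A with covers (boundedBy⇒< A-bounded x∈A) x∈A
    ... | y , s≤s y≤x , y∈B , x∸y∈ = y , x ∸ y , m+[n∸m]≡n y≤x , y∈B , x∸y∈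
    compose : InSumset _ _ x → x ∈ˢ A
    compose (y , z , refl , y∈B , z∈) = maximalComplement-sound B-bounded z∈ y∈B

  isSumset⇒covers : ∀ {B C} → IsSumset B C A → Covers B
  isSumset⇒covers {B} A≐B+C {x} _ x∈A with proj₁ (A≐B+C x) x∈A
  ... | y , z , refl , y∈B , z∈C =
    y , s≤s (m≤m+n y z) , y∈B ,
    subst (_∈ˢ maximalComplement B) (sym (m+n∸m≡n y z)) (maximalComplement-maximal A≐B+C z∈C)

  subsetsBelow : ℕ → List Subset
  subsetsBelow = functionsBelow (const (true ∷ false ∷ [])) false

  additiveDivisors : List Subset
  additiveDivisors = filter covers? (subsetsBelow N)

  ∈-additiveDivisors⁻ : ∀ {B} → B ∈ additiveDivisors → BoundedBy N B × AdditiveDivisor A B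
  ∈-additiveDivisors⁻ B∈ with ∈-filter⁻ covers? B∈
  ... | B∈subsets , covers = B-bounded , maximalComplement _ , covers⇒isSumset B-bounded covers
    where
    B-bounded = λ x → proj₂ (∈-functionsBelow⁻ _ false N B∈subsets)

  additiveDivisors-distinct : AllPairs (λ B B' → ¬ AgreeBelow N B B') additiveDivisors
  additiveDivisors-distinct =
    AllPairsₚ.filter⁺ covers? (functionsBelow-distinct false N (λ _ → ((λ ()) All.∷ All.[]) ∷ All.[] ∷ []))

  additiveDivisors-complete : NonemptySet A → ∀ {B} → AdditiveDivisor A B → Any (B ≗_) additiveDivisors
  additiveDivisors-complete A-nonempty {B} (C , A≐B+C) =
    let B' , B'∈ , B≗B' = find (functionsBelow-complete _ false N (in-choices , B-bounded _))
    in lose (∈-filter⁺ covers? B'∈ (isSumset⇒covers (proj₂ (additiveDivisor-resp B≗B' (C , A≐B+C))))) B≗B'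
    where
    B-bounded : BoundedBy N B
    B-bounded = isSumset-boundedˡ A-bounded A≐B+C (proj₂ (proj₂ (summands-nonempty A-nonempty A≐B+C)))
    in-choices : ∀ {x} → x < N → B x ∈ true ∷ false ∷ []
    in-choices {x} _ with B x
    ... | true = here refl
    ... | false = there (here refl)

positive : ℕ → Bool
positive zero = false
positive (suc _) = true

support : (ℕ → ℕ) → Subset
support g x = positive (g x)

positive⇒1≤ : ∀ {n} → positive n ≡ true → 1 ≤ n
positive⇒1≤ {suc n} _ = s≤s z≤n

1≤⇒positive : ∀ {n} → 1 ≤ n → positive n ≡ true
1≤⇒positive (s≤s _) = refl

¬positive⇒≡0 : ∀ {n} → positive n ≡ false → n ≡ 0
¬positive⇒≡0 {zero} _ = refl

indicator≤1 : ∀ A x → indicator A x ≤ 1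
indicator≤1 A x with A x
... | true = ≤-refl
... | false = z≤n

∈⇒1≤indicator : ∀ A {x} → x ∈ˢ A → 1 ≤ indicator A x
∈⇒1≤indicator A {x} x∈A rewrite x∈A = ≤-refl

1≤indicator⇒∈ : ∀ A {x} → 1 ≤ indicator A x → x ∈ˢ A
1≤indicator⇒∈ A {x} 1≤Ax with A x
... | true = refl

isSumM⇒isSumset : ∀ {b g h A} → 1 ≤ b → IsSumM b g h (indicator A) → IsSumset (support g) (support h) A
isSumM⇒isSumset {g = g} {h} {A} 1≤b f≐g+h x = decompose , compose
  where
  level1 = f≐g+h 1 ≤-refl 1≤b x
  decompose : x ∈ˢ A → InSumset (support g) (support h) x
  decompose x∈A =
    let y , z , y+z≡x , 1≤gy , 1≤hz = proj₁ level1 (∈⇒1≤indicator A x∈A)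
    in y , z , y+z≡x , 1≤⇒positive 1≤gy , 1≤⇒positive 1≤hz
  compose : InSumset (support g) (support h) x → x ∈ˢ A
  compose (y , z , y+z≡x , y∈ , z∈) =
    1≤indicator⇒∈ A (proj₂ level1 (y , z , y+z≡x , positive⇒1≤ y∈ , positive⇒1≤ z∈))

-- Levels i ≥ 2 are empty on both sides, as indicator A and indicator C are 0/1-valued.
isSumset⇒isSumM : ∀ {b g A C} → IsSumset (support g) C A → IsSumM b g (indicator C) (indicator A)
isSumset⇒isSumM {g = g} {A} {C} A≐B+C i 1≤i _ x = decompose , compose
  where
  Decomposition = ∃[ y ] ∃[ z ] (y + z ≡ x × i ≤ g y × i ≤ indicator C z)
  decompose : i ≤ indicator A x → Decomposition
  decompose i≤Ax =
    let i≤1 = ≤-trans i≤Ax (indicator≤1 A x)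
        y , z , y+z≡x , y∈ , z∈C = proj₁ (A≐B+C x) (1≤indicator⇒∈ A (≤-trans 1≤i i≤Ax))
    in y , z , y+z≡x , ≤-trans i≤1 (positive⇒1≤ y∈) , ≤-trans i≤1 (∈⇒1≤indicator C z∈C)
  compose : Decomposition → i ≤ indicator A x
  compose (y , z , y+z≡x , i≤gy , i≤Cz) =
    let x∈A = proj₂ (A≐B+C x)
                (y , z , y+z≡x , 1≤⇒positive (≤-trans 1≤i i≤gy) , 1≤indicator⇒∈ C (≤-trans 1≤i i≤Cz))
    in ≤-trans i≤Cz (≤-trans (indicator≤1 C z) (∈⇒1≤indicator A x∈A))

support-boundedBy : ∀ {N g} → BoundedBy N (support g) → ∀ x → N ≤ x → g x ≡ 0
support-boundedBy bounded x N≤x = ¬positive⇒≡0 (bounded x N≤x)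

indicator-boundedBy : ∀ {N C} → BoundedBy N C → ∀ x → N ≤ x → indicator C x ≡ 0
indicator-boundedBy bounded x N≤x rewrite bounded x N≤x = refl

divisor⇒additiveDivisor : ∀ {b A g} → 1 ≤ b → DivisorM b (indicator A) g →
                          (∀ x → g x ≤ b) × AdditiveDivisor A (support g)
divisor⇒additiveDivisor 1≤b ((g≤b , _) , h , _ , f≐g+h) = g≤b , support h , isSumM⇒isSumset 1≤b f≐g+h

additiveDivisor⇒divisor : ∀ {N A b g} → BoundedBy N A → NonemptySet A → 1 ≤ b → (∀ x → g x ≤ b) →
                          AdditiveDivisor A (support g) → DivisorM b (indicator A) g
additiveDivisor⇒divisor {N} A-bounded A-nonempty 1≤b g≤b (C , A≐B+C) =
    (g≤b , N , support-boundedBy (isSumset-boundedˡ A-bounded A≐B+C (proj₂ (proj₂ nonempty))))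
  , indicator C
  , ((λ z → ≤-trans (indicator≤1 C z) 1≤b) ,
     N , indicator-boundedBy (isSumset-boundedʳ A-bounded A≐B+C (proj₂ (proj₁ nonempty))))
  , isSumset⇒isSumM A≐B+C
  where
  nonempty = summands-nonempty A-nonempty A≐B+C

admissibleValues : ℕ → Subset → ℕ → List ℕ
admissibleValues b B x = if B x then applyUpTo suc b else [ 0 ]

∈-admissibleValues⁻ : ∀ b B x {v} → v ∈ admissibleValues b B x → positive v ≡ B x × v ≤ b
∈-admissibleValues⁻ b B x v∈ with B x
... | false with here refl ← v∈ = refl , z≤n
... | true with Anyₚ.applyUpTo⁻ suc v∈
...   | _ , i<b , refl = refl , i<b

∈-admissibleValues⁺ : ∀ b B x {v} → positive v ≡ B x → v ≤ b → v ∈ admissibleValues b B x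
∈-admissibleValues⁺ b B x {v} positive≡B v≤b with B x | v
... | false | zero = here refl
... | true  | suc i = Anyₚ.applyUpTo⁺ suc refl v≤b

admissibleValues-distinct : ∀ b B x → AllPairs _≢_ (admissibleValues b B x)
admissibleValues-distinct b B x with B x
... | false = All.[] ∷ []
... | true = AllPairsₚ.applyUpTo⁺₁ suc b (λ i<j _ → <⇒≢ i<j ∘ suc-injective)

length-admissibleValues : ∀ b B x → length (admissibleValues b B x) ≡ b ^ indicator B x
length-admissibleValues b B x with B x
... | false = refl
... | true = trans (length-applyUpTo suc b) (sym (*-identityʳ b))

product-applyUpTo-countBelow : ∀ b B {w} → (∀ x → w x ≡ b ^ indicator B x) → ∀ n →
                               product (applyUpTo w n) ≡ b ^ countBelow B n
product-applyUpTo-countBelow b B w≡ zero = refl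
product-applyUpTo-countBelow b B {w} w≡ (suc n) = begin
  product (applyUpTo w (suc n))                  ≡⟨ cong product (applyUpTo-∷ʳ w n) ⟨
  product (applyUpTo w n ++ [ w n ])             ≡⟨ product-++ (applyUpTo w n) [ w n ] ⟩
  product (applyUpTo w n) * (w n * 1)            ≡⟨ cong₂ _*_ (product-applyUpTo-countBelow b B w≡ n)
                                                              (trans (*-identityʳ (w n)) (w≡ n)) ⟩
  b ^ countBelow B n * b ^ indicator B n         ≡⟨ *-comm (b ^ countBelow B n) _ ⟩
  b ^ indicator B n * b ^ countBelow B n         ≡⟨ ^-distribˡ-+-* b (indicator B n) (countBelow B n) ⟨
  b ^ countBelow B (suc n)                       ∎
  where open ≡-Reasoning

module _ (b N : ℕ) where

  functionsWithSupport : Subset → List (ℕ → ℕ)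
  functionsWithSupport B = functionsBelow (admissibleValues b B) 0 N

  ∈-functionsWithSupport⁻ : ∀ {B g} → g ∈ functionsWithSupport B →
                            AgreeBelow N (support g) B × BoundedBy N (support g) × (∀ x → g x ≤ b)
  ∈-functionsWithSupport⁻ {B} {g} g∈ = agree , bounded , g≤b
    where
    chosen = ∈-functionsBelow⁻ _ 0 N g∈
    agree : AgreeBelow N (support g) B
    agree {x} x<N = proj₁ (∈-admissibleValues⁻ b B x (proj₁ chosen x<N))
    bounded : BoundedBy N (support g)
    bounded x N≤x = cong positive (proj₂ chosen N≤x)
    g≤b : ∀ x → g x ≤ b
    g≤b x with ≤-<-connex N x
    ... | inj₁ N≤x = subst (_≤ b) (sym (proj₂ chosen N≤x)) z≤n
    ... | inj₂ x<N = proj₂ (∈-admissibleValues⁻ b B x (proj₁ chosen x<N))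

  functionsWithSupport-complete : ∀ {B g} → BoundedBy N B → support g ≗ B → (∀ x → g x ≤ b) →
                                  Any (g ≗_) (functionsWithSupport B)
  functionsWithSupport-complete {B} B-bounded supp≗B g≤b =
    functionsBelow-complete _ 0 N ((λ {x} _ → ∈-admissibleValues⁺ b B x (supp≗B x) (g≤b x)) ,
                                   λ {x} N≤x → ¬positive⇒≡0 (trans (supp≗B x) (B-bounded x N≤x)))

  functionsWithSupport-distinct : ∀ B → AllPairs (λ g g' → ¬ g ≗ g') (functionsWithSupport B)
  functionsWithSupport-distinct B = AllPairs.map (λ disagree g≗g' → disagree (λ {x} _ → g≗g' x))
                                      (functionsBelow-distinct 0 N (admissibleValues-distinct b B))

  length-functionsWithSupport : ∀ B → length (functionsWithSupport B) ≡ b ^ countBelow B N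
  length-functionsWithSupport B =
    trans (length-functionsBelow (admissibleValues b B) 0 N)
          (product-applyUpTo-countBelow b B (length-admissibleValues b B) N)

module Counting {b N : ℕ} {A : Subset} (1≤b : 1 ≤ b) (A-bounded : BoundedBy N A) (A-nonempty : NonemptySet A) where
  open MaximalComplement A-bounded

  divisors : List (ℕ → ℕ)
  divisors = concatMap (functionsWithSupport b N) additiveDivisors

  weightedCount : ℕ
  weightedCount = sum (map (λ B → b ^ countBelow B N) additiveDivisors)

  divisors-sound : All (DivisorM b (indicator A)) divisors
  divisors-sound = All.tabulate λ g∈ →
    let B , B∈ , g∈B = find (Anyₚ.concatMap⁻ (functionsWithSupport b N) g∈)
        B-bounded , B-divisor = ∈-additiveDivisors⁻ B∈
        agree , support-bounded , g≤b = ∈-functionsWithSupport⁻ b N g∈B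
        support≗B = agreeBelow⇒≗ support-bounded B-bounded agree
    in additiveDivisor⇒divisor A-bounded A-nonempty 1≤b g≤b (additiveDivisor-resp (sym ∘ support≗B) B-divisor)

  divisors-distinct : AllPairs (λ g g' → ¬ g ≗ g') divisors
  divisors-distinct =
    AllPairsₚ.concat⁺ (Allₚ.map⁺ (All.universal (functionsWithSupport-distinct b N) additiveDivisors))
                      (AllPairsₚ.map⁺ (AllPairs.map supports-differ additiveDivisors-distinct))
    where
    supports-differ : ∀ {B B'} → ¬ AgreeBelow N B B' →
                      All (λ g → All (λ g' → ¬ g ≗ g') (functionsWithSupport b N B')) (functionsWithSupport b N B)
    supports-differ disagree = All.tabulate λ g∈ → All.tabulate λ g'∈ g≗g' → disagree λ x<N →
      trans (sym (proj₁ (∈-functionsWithSupport⁻ b N g∈) x<N))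
            (trans (cong positive (g≗g' _)) (proj₁ (∈-functionsWithSupport⁻ b N g'∈) x<N))

  divisors-complete : ∀ g → DivisorM b (indicator A) g → Any (g ≗_) divisors
  divisors-complete g g-divisor =
    let g≤b , support-divisor = divisor⇒additiveDivisor 1≤b g-divisor
        B , B∈ , support≗B = find (additiveDivisors-complete A-nonempty support-divisor)
        B-bounded = proj₁ (∈-additiveDivisors⁻ B∈)
    in Anyₚ.concatMap⁺ (functionsWithSupport b N)
         (lose B∈ (functionsWithSupport-complete b N B-bounded support≗B g≤b))

  length-divisors : length divisors ≡ weightedCount
  length-divisors = trans (length-concatMap (functionsWithSupport b N) additiveDivisors)
                          (cong sum (map-cong (length-functionsWithSupport b N) additiveDivisors))

  withCardinality : Subset → Subset × ℕ
  withCardinality B = B , countBelow B N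

  sumOverAdditiveDivisors : SumOverAdditiveDivisors b A weightedCount
  sumOverAdditiveDivisors =
      map withCardinality additiveDivisors
    , Allₚ.map⁺ (All.tabulate λ B∈ →
        let B-bounded , B-divisor = ∈-additiveDivisors⁻ B∈ in B-divisor , N , B-bounded , refl)
    , AllPairsₚ.map⁺ (AllPairs.map (λ disagree B≗B' → disagree λ {x} _ → B≗B' x) additiveDivisors-distinct)
    , (λ B B-divisor → Anyₚ.map⁺ (additiveDivisors-complete A-nonempty B-divisor))
    , cong sum (sym (map-∘ additiveDivisors))

mainTheorem11 : (b : ℕ) → 1 ≤ b → (A : Subset) → FiniteSet A → NonemptySet A →
    ∃[ n ] (NumDivisors b (indicator A) n × SumOverAdditiveDivisors b A n)
mainTheorem11 b 1≤b A (N , A-bounded) A-nonempty =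
    weightedCount
  , (divisors , divisors-sound , divisors-distinct , divisors-complete , length-divisors)
  , sumOverAdditiveDivisors
  where open Counting 1≤b A-bounded A-nonempty
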